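{- Let $m\ge 3$, $k\ge 2$, and let $G_1 = C_m^{u_1,\dots,u_k}(l_1,\dots,l_k)$ be a unicyclic graph with $l_1,\dots,l_k\ge 1$. Suppose that for some $1\le i\le k-1$, $u_iu_{i+1}\in E(C_m)$, and let $y_1$ be the neighbor of $u_i$ on $C_m$ other than $u_{i+1}$. If $d_{G_1}(y_1) \le d_{G_1}(u_{i+1})$ and $d_{G_1}(u_1) \le d_{G_1}(u_{i+1})$, then $HM(G_1) < HM(G_2)$, where $G_2$ is the graph obtained from $G_1$ by deleting the $l_i$ pendant vertices at $u_i$ and attaching $l_i$ new pendant vertices to $u_{i+1}$ (so that $u_{i+1}$ carries $l_i+l_{i+1}$ pendant vertices), i.e. $G_2 = C_m(l_1,\dots,l_{i-1},l_i+l_{i+1},l_{i+2},\dots,l_k)$.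
   Context: A unicyclic graph is a connected graph with exactly one cycle. $C_m^{u_1,\dots,u_k}(l_1,\dots,l_k)$ denotes the graph obtained from the cycle $C_m$ with distinct vertices $u_1,\dots,u_k$ by attaching $l_j$ pendant vertices to $u_j$ for each $j$. $d_G$ denotes vertex degree and $HM(G)=\sum_{xy\in E(G)}(d_G(x)+d_G(y))^2$. -}

module Defs where

open import Data.Nat using (ℕ; zero; suc; _+_; _*_; _^_; _≤_; _<_)
open import Data.Nat.DivMod using (_mod_)
open import Data.Fin using (Fin; toℕ) renaming (_≟_ to _≟ᶠ_)
open import Data.Nat using () renaming (_≟_ to _≟ⁿ_)
open import Data.Sum using (_⊎_; inj₁; inj₂)
open import Data.Product using (_×_; _,_; proj₁; proj₂)
import Data.Sum.Properties as SumP
import Data.Product.Properties as ProdP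
open import Data.Nat.ListAction using (sum)
open import Data.List using (List; []; _∷_; map; upTo; allFin; concatMap; _++_)
open import Data.Bool using (Bool; true; false; if_then_else_; _∨_)
open import Relation.Nullary using (does)
open import Relation.Binary.PropositionalEquality using (_≡_)

record Graph : Set₁ where
  field
    V     : Set
    _≟V_  : (x y : V) → Relation.Nullary.Dec (x ≡ y)
    edges : List (V × V)
open Graph public

deg : (G : Graph) → V G → ℕ
deg G x = sum (map (λ e → if does (_≟V_ G (proj₁ e) x) ∨ does (_≟V_ G (proj₂ e) x) then 1 else 0) (edges G))

HM : Graph → ℕ
HM G = sum (map (λ e → (deg G (proj₁ e) + deg G (proj₂ e)) ^ 2) (edges G))

next : ∀ {m} → Fin m → Fin m
next {suc n} i = suc (toℕ i) mod suc n

CycleAdj : ∀ {m} → Fin m → Fin m → Set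
CycleAdj x y = (next x ≡ y) ⊎ (next y ≡ x)

-- vertices: cycle vertices inj₁ v, and pendant vertices inj₂ (v , t)
-- (the t-th pendant vertex attached at cycle vertex v)
CVert : ℕ → Set
CVert m = Fin m ⊎ (Fin m × ℕ)

cycleWithPendants : (m : ℕ) → (Fin m → ℕ) → Graph
cycleWithPendants m P = record
  { V = CVert m
  ; _≟V_ = SumP.≡-dec _≟ᶠ_ (ProdP.≡-dec _≟ᶠ_ _≟ⁿ_)
  ; edges = map (λ i → (inj₁ i , inj₁ (next i))) (allFin m)
            ++ concatMap (λ v → map (λ t → (inj₁ v , inj₂ (v , t))) (upTo (P v))) (allFin m)
  }

pendCount : ∀ {m k} → (Fin k → Fin m) → (Fin k → ℕ) → Fin m → ℕ
pendCount {k = k} u l v = sum (map (λ j → if does (u j ≟ᶠ v) then l j else 0) (allFin k))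

C[_,_,_] : (m : ℕ) {k : ℕ} → (Fin k → Fin m) → (Fin k → ℕ) → Graph
C[ m , u , l ] = cycleWithPendants m (pendCount u l)

-- the list (l_1,…,l_{i-1}, 0, l_i + l_{i+1}, l_{i+2},…,l_k): pendants moved from u_i to u_{i+1}
movePendants : ∀ {k} → (Fin k → ℕ) → (i j : Fin k) → Fin k → ℕ
movePendants l i j r =
  if does (r ≟ᶠ i) then 0 else (if does (r ≟ᶠ j) then l i + l j else l r)

-- With P v pendants at cycle vertex v, cycle vertices have degree 2 + P v and pendants degree 1, so
-- HM = Σᵢ (4 + P i + P (next i))² + Σᵥ P v (3 + P v)².  Moving the pendants of a to its neighbour b
-- raises the second sum strictly, as p ↦ p (3 + p)² is strictly superadditive on positive integers.
-- In the first sum only the edges ya and bz (z the other neighbour of b) change: the pendant count at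
-- the ends of ya drops by P a down to P y, that of bz grows by P a from P b + P z ≥ P y, and by
-- convexity of squares the gain outweighs the loss.
module Submission where

open import Defs
open import Data.Bool using (if_then_else_; _∨_)
open import Data.Empty.Polymorphic using (⊥)
open import Data.Fin using (Fin; toℕ; fromℕ; fromℕ<; inject₁; _≟_) renaming (zero to fzero; suc to fsuc)
open import Data.Fin.Properties using (toℕ-injective; toℕ-fromℕ<; toℕ-fromℕ; toℕ-inject₁; inject₁ℕ<; toℕ<n; suc-injective)
open import Data.Fin.Relation.Unary.Top using (view; ‵fromℕ; ‵inject₁)
open import Data.List using (List; []; _∷_; _++_; map; tabulate; applyUpTo; concatMap; allFin; upTo)
open import Data.List.Properties using (map-++; map-tabulate; map-applyUpTo)
open import Data.Nat using (ℕ; zero; suc; _+_; _*_; _^_; _≤_; _<_; z≤n; s≤s)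
open import Data.Nat.DivMod using (_%_; m<n⇒m%n≡m; n%n≡0)
open import Data.Nat.ListAction using (sum)
open import Data.Nat.ListAction.Properties using (sum-++)
open import Data.Nat.Properties
  using ( +-comm; +-assoc; +-identityʳ; *-identityʳ; *-distribʳ-+; 1+n≢n; ≤-reflexive; ≤-trans
        ; m≤m+n; m≤n+m; m<m+n; +-mono-≤; +-mono-<-≤; +-mono-≤-<; +-monoʳ-≤; +-monoʳ-<; *-monoʳ-≤; *-monoʳ-<
        ; ^-monoˡ-≤; ^-monoˡ-<; +-cancelˡ-≤; m≤n⇒∃[o]m+o≡n; +-commutativeSemigroup; +-0-commutativeMonoid
        ; module ≤-Reasoning )
open import Algebra.Properties.CommutativeSemigroup +-commutativeSemigroup using (x∙yz≈y∙xz)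
open import Algebra.Properties.CommutativeMonoid.Sum +-0-commutativeMonoid
  using (sum-syntax; sum-cong-≗; sum-replicate-zero) renaming (sum to ∑)
open import Data.Nat.Solver using (module +-*-Solver)
open import Data.Nat.Tactic.RingSolver using (solve-∀)
open import Data.Product using (_×_; _,_; proj₁; proj₂)
open import Data.Product.Properties using (,-injectiveˡ; ,-injectiveʳ)
open import Data.Sum using (_⊎_; inj₁; inj₂)
open import Data.Sum.Properties using (inj₂-injective)
open import Data.Vec.Functional using (Vector; updateAt)
open import Data.Vec.Functional.Properties using (updateAt-updates; updateAt-minimal)
open import Function using (_∘_; id; case_of_)
open import Function.Definitions using (Injective)
open import Level using (0ℓ)
open import Relation.Nullary using (Dec; yes; no; does; ¬_; contradiction)
open import Relation.Nullary.Decidable using (dec-true; dec-false; _⊎-dec_; ⊥-dec)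
open import Relation.Binary.PropositionalEquality

private variable
  A B : Set
  m n : ℕ

_[_]≔0 : Vector ℕ n → Fin n → Vector ℕ n
f [ j ]≔0 = updateAt f j (λ _ → 0)

∑-pull : (j : Fin n) (f : Vector ℕ n) → ∑ f ≡ f j + ∑ (f [ j ]≔0)
∑-pull fzero    f = refl
∑-pull (fsuc j) f =
  trans (cong (f fzero +_) (∑-pull j (f ∘ fsuc))) (x∙yz≈y∙xz (f fzero) (f (fsuc j)) (∑ ((f ∘ fsuc) [ j ]≔0)))

∑-pull₂ : {p q : Fin n} (f : Vector ℕ n) → p ≢ q → ∑ f ≡ f p + f q + ∑ (f [ p ]≔0 [ q ]≔0)
∑-pull₂ {p = p} {q} f p≢q = begin
  ∑ f                                            ≡⟨ ∑-pull p f ⟩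
  f p + ∑ (f [ p ]≔0)                            ≡⟨ cong (f p +_) (∑-pull q (f [ p ]≔0)) ⟩
  f p + ((f [ p ]≔0) q + ∑ (f [ p ]≔0 [ q ]≔0)) ≡⟨ cong (λ x → f p + (x + ∑ (f [ p ]≔0 [ q ]≔0)))
                                                         (updateAt-minimal q p f (p≢q ∘ sym)) ⟩
  f p + (f q + ∑ (f [ p ]≔0 [ q ]≔0))           ≡⟨ +-assoc (f p) (f q) _ ⟨
  f p + f q + ∑ (f [ p ]≔0 [ q ]≔0)             ∎
  where open ≡-Reasoning

[]≔0-zero : (j : Fin n) {f : Vector ℕ n} → ∀ i → (i ≢ j → f i ≡ 0) → (f [ j ]≔0) i ≡ 0
[]≔0-zero j {f} i f-off with i ≟ j
... | yes refl = updateAt-updates j f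
... | no i≢j   = trans (updateAt-minimal i j f i≢j) (f-off i≢j)

[]≔0-mono : (j : Fin n) {f g : Vector ℕ n} → ∀ i → (i ≢ j → f i ≤ g i) → (f [ j ]≔0) i ≤ (g [ j ]≔0) i
[]≔0-mono j {f} {g} i f≤g-off with i ≟ j
... | yes refl = ≤-reflexive (trans (updateAt-updates j f) (sym (updateAt-updates j g)))
... | no i≢j   = subst₂ _≤_ (sym (updateAt-minimal i j f i≢j)) (sym (updateAt-minimal i j g i≢j)) (f≤g-off i≢j)

∑-mono-≤ : {f g : Vector ℕ n} → (∀ i → f i ≤ g i) → ∑ f ≤ ∑ g
∑-mono-≤ {zero}  f≤g = z≤n
∑-mono-≤ {suc n} f≤g = +-mono-≤ (f≤g fzero) (∑-mono-≤ (f≤g ∘ fsuc))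

∑-zero : {f : Vector ℕ n} → (∀ i → f i ≡ 0) → ∑ f ≡ 0
∑-zero {n} f≗0 = trans (sum-cong-≗ f≗0) (sum-replicate-zero n)

∑-const : ∀ n c → ∑[ i < n ] c ≡ n * c
∑-const zero    c = refl
∑-const (suc n) c = cong (c +_) (∑-const n c)

∑-supported₁ : {j : Fin n} (f : Vector ℕ n) → (∀ i → i ≢ j → f i ≡ 0) → ∑ f ≡ f j
∑-supported₁ {j = j} f f-off = begin
  ∑ f                 ≡⟨ ∑-pull j f ⟩
  f j + ∑ (f [ j ]≔0) ≡⟨ cong (f j +_) (∑-zero λ i → []≔0-zero j i (f-off i)) ⟩
  f j + 0             ≡⟨ +-identityʳ (f j) ⟩
  f j                 ∎
  where open ≡-Reasoning

∑-supported₂ : {p q : Fin n} (f : Vector ℕ n) → p ≢ q → (∀ i → i ≢ p → i ≢ q → f i ≡ 0) → ∑ f ≡ f p + f q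
∑-supported₂ {p = p} {q} f p≢q f-off =
  trans (∑-pull₂ f p≢q) (trans (cong (f p + f q +_) (∑-zero rest≡0)) (+-identityʳ _))
  where
  rest≡0 : ∀ i → (f [ p ]≔0 [ q ]≔0) i ≡ 0
  rest≡0 i = []≔0-zero q i λ i≢q → []≔0-zero p i λ i≢p → f-off i i≢p i≢q

module _ {p q : Fin n} (f g : Vector ℕ n) (p≢q : p ≢ q) (f≤g-off : ∀ i → i ≢ p → i ≢ q → f i ≤ g i) where

  private
    rest-≤ : ∀ i → (f [ p ]≔0 [ q ]≔0) i ≤ (g [ p ]≔0 [ q ]≔0) i
    rest-≤ i = []≔0-mono q i λ i≢q → []≔0-mono p i λ i≢p → f≤g-off i i≢p i≢q

  ∑-mono-≤-except₂ : f p + f q ≤ g p + g q → ∑ f ≤ ∑ g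
  ∑-mono-≤-except₂ le = subst₂ _≤_ (sym (∑-pull₂ f p≢q)) (sym (∑-pull₂ g p≢q)) (+-mono-≤ le (∑-mono-≤ rest-≤))

  ∑-mono-<-except₂ : f p + f q < g p + g q → ∑ f < ∑ g
  ∑-mono-<-except₂ lt = subst₂ _<_ (sym (∑-pull₂ f p≢q)) (sym (∑-pull₂ g p≢q)) (+-mono-<-≤ lt (∑-mono-≤ rest-≤))

if-yes : (d : Dec A) → A → {x y : B} → (if does d then x else y) ≡ x
if-yes d a = cong (λ b → if b then _ else _) (dec-true d a)

if-no : (d : Dec A) → ¬ A → {x y : B} → (if does d then x else y) ≡ y
if-no d ¬a = cong (λ b → if b then _ else _) (dec-false d ¬a)

next-fromℕ : next (fromℕ n) ≡ fzero
next-fromℕ {n} = toℕ-injective (begin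
  toℕ (next (fromℕ n))        ≡⟨ toℕ-fromℕ< _ ⟩
  suc (toℕ (fromℕ n)) % suc n ≡⟨ cong (λ x → suc x % suc n) (toℕ-fromℕ n) ⟩
  suc n % suc n               ≡⟨ n%n≡0 (suc n) ⟩
  0                           ∎)
  where open ≡-Reasoning

next-inject₁ : (i : Fin n) → next (inject₁ i) ≡ fsuc i
next-inject₁ {n} i = toℕ-injective (begin
  toℕ (next (inject₁ i))        ≡⟨ toℕ-fromℕ< _ ⟩
  suc (toℕ (inject₁ i)) % suc n ≡⟨ m<n⇒m%n≡m (s≤s (inject₁ℕ< i)) ⟩
  suc (toℕ (inject₁ i))         ≡⟨ cong suc (toℕ-inject₁ i) ⟩
  suc (toℕ i)                   ∎)
  where open ≡-Reasoning

next-injective : {x y : Fin (suc n)} → next x ≡ next y → x ≡ y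
next-injective {x = x} {y} eq with view x | view y
... | ‵fromℕ     | ‵fromℕ     = refl
... | ‵fromℕ     | ‵inject₁ j = case trans (sym next-fromℕ) (trans eq (next-inject₁ j)) of λ ()
... | ‵inject₁ i | ‵fromℕ     = case trans (sym (next-inject₁ i)) (trans eq next-fromℕ) of λ ()
... | ‵inject₁ i | ‵inject₁ j =
  cong inject₁ (suc-injective (trans (sym (next-inject₁ i)) (trans eq (next-inject₁ j))))

next-≢ : (x : Fin (suc (suc n))) → next x ≢ x
next-≢ x with view x
... | ‵fromℕ     = λ eq → case trans (sym next-fromℕ) eq of λ ()
... | ‵inject₁ i = λ eq → 1+n≢n (trans (cong toℕ (trans (sym (next-inject₁ i)) eq)) (toℕ-inject₁ i))

prev : Fin (suc n) → Fin (suc n)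
prev fzero    = fromℕ _
prev (fsuc i) = inject₁ i

next-prev : (x : Fin (suc n)) → next (prev x) ≡ x
next-prev fzero    = next-fromℕ
next-prev (fsuc i) = next-inject₁ i

CycleAdj⇒≢ : {a b : Fin (suc (suc n))} → CycleAdj a b → a ≢ b
CycleAdj⇒≢ (inj₁ next[a]≡b) refl = next-≢ _ next[a]≡b
CycleAdj⇒≢ (inj₂ next[b]≡a) refl = next-≢ _ next[b]≡a

module _ {a b y : Fin (suc n)} (y≢b : y ≢ b) where

  neighbour≢succ⇒pred : next a ≡ b → CycleAdj a y → next y ≡ a
  neighbour≢succ⇒pred next[a]≡b (inj₁ next[a]≡y) = contradiction (trans (sym next[a]≡y) next[a]≡b) y≢b
  neighbour≢succ⇒pred next[a]≡b (inj₂ next[y]≡a) = next[y]≡a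

  neighbour≢pred⇒succ : next b ≡ a → CycleAdj a y → next a ≡ y
  neighbour≢pred⇒succ next[b]≡a (inj₁ next[a]≡y) = next[a]≡y
  neighbour≢pred⇒succ next[b]≡a (inj₂ next[y]≡a) =
    contradiction (next-injective (trans next[y]≡a (sym next[b]≡a))) y≢b

sum-map-tabulate : (f : A → ℕ) (g : Fin n → A) → sum (map f (tabulate g)) ≡ ∑[ i < n ] f (g i)
sum-map-tabulate {n = zero}  f g = refl
sum-map-tabulate {n = suc n} f g = cong (f (g fzero) +_) (sum-map-tabulate f (g ∘ fsuc))

sum-map-applyUpTo : (f : A → ℕ) (g : ℕ → A) (n : ℕ) → sum (map f (applyUpTo g n)) ≡ ∑[ t < n ] f (g (toℕ t))
sum-map-applyUpTo f g zero    = refl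
sum-map-applyUpTo f g (suc n) = cong (f (g 0) +_) (sum-map-applyUpTo f (g ∘ suc) n)

sum-map-concatMap : (f : B → ℕ) (h : A → List B) (xs : List A) →
  sum (map f (concatMap h xs)) ≡ sum (map (λ x → sum (map f (h x))) xs)
sum-map-concatMap f h []       = refl
sum-map-concatMap f h (x ∷ xs) = begin
  sum (map f (h x ++ concatMap h xs))              ≡⟨ cong sum (map-++ f (h x) _) ⟩
  sum (map f (h x) ++ map f (concatMap h xs))      ≡⟨ sum-++ (map f (h x)) _ ⟩
  sum (map f (h x)) + sum (map f (concatMap h xs)) ≡⟨ cong (sum (map f (h x)) +_) (sum-map-concatMap f h xs) ⟩
  sum (map f (h x)) + sum (map (λ x → sum (map f (h x))) xs) ∎
  where open ≡-Reasoning

sum-edges : (P : Fin m → ℕ) (f : CVert m × CVert m → ℕ) → sum (map f (edges (cycleWithPendants m P)))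
  ≡ ∑[ i < m ] f (inj₁ i , inj₁ (next i)) + ∑[ v < m ] ∑[ t < P v ] f (inj₁ v , inj₂ (v , toℕ t))
sum-edges {m} P f = begin
  sum (map f (cycleEdges ++ pendantEdges))          ≡⟨ cong sum (map-++ f cycleEdges _) ⟩
  sum (map f cycleEdges ++ map f pendantEdges)      ≡⟨ sum-++ (map f cycleEdges) _ ⟩
  sum (map f cycleEdges) + sum (map f pendantEdges) ≡⟨ cong₂ _+_ cycles pendants ⟩
  ∑[ i < m ] f (cycleEdge i) + ∑[ v < m ] ∑[ t < P v ] f (pendantEdge v (toℕ t)) ∎
  where
  open ≡-Reasoning
  cycleEdge : Fin m → CVert m × CVert m
  cycleEdge i = inj₁ i , inj₁ (next i)
  pendantEdge : Fin m → ℕ → CVert m × CVert m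
  pendantEdge v t = inj₁ v , inj₂ (v , t)
  cycleEdges pendantEdges : List (CVert m × CVert m)
  cycleEdges = map cycleEdge (allFin m)
  pendantEdges = concatMap (λ v → map (pendantEdge v) (upTo (P v))) (allFin m)
  cycles : sum (map f cycleEdges) ≡ ∑[ i < m ] f (cycleEdge i)
  cycles = trans (cong (sum ∘ map f) (map-tabulate id cycleEdge)) (sum-map-tabulate f cycleEdge)
  pendantsAt : ∀ v → sum (map f (map (pendantEdge v) (upTo (P v)))) ≡ ∑[ t < P v ] f (pendantEdge v (toℕ t))
  pendantsAt v = trans (cong (sum ∘ map f) (map-applyUpTo id (pendantEdge v) (P v)))
                       (sum-map-applyUpTo f (pendantEdge v) (P v))
  pendants : sum (map f pendantEdges) ≡ ∑[ v < m ] ∑[ t < P v ] f (pendantEdge v (toℕ t))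
  pendants = begin
    sum (map f pendantEdges)                                 ≡⟨ sum-map-concatMap f _ (allFin m) ⟩
    sum (map (λ v → sum (map f (map (pendantEdge v) (upTo (P v))))) (allFin m))
      ≡⟨ sum-map-tabulate (λ v → sum (map f (map (pendantEdge v) (upTo (P v))))) id ⟩
    ∑[ v < m ] sum (map f (map (pendantEdge v) (upTo (P v)))) ≡⟨ sum-cong-≗ pendantsAt ⟩
    ∑[ v < m ] ∑[ t < P v ] f (pendantEdge v (toℕ t))         ∎

module _ (P : Fin (suc (suc n)) → ℕ) where

  private
    G : Graph
    G = cycleWithPendants (suc (suc n)) P

    incident : CVert (suc (suc n)) → CVert (suc (suc n)) × CVert (suc (suc n)) → ℕ
    incident x e = if does (_≟V_ G (proj₁ e) x) ∨ does (_≟V_ G (proj₂ e) x) then 1 else 0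

  deg-inj₁ : (v : Fin (suc (suc n))) → deg G (inj₁ v) ≡ 2 + P v
  deg-inj₁ v = trans (sum-edges P (incident (inj₁ v))) (cong₂ _+_ cycleNeighbours pendantNeighbours)
    where
    v≢prev : v ≢ prev v
    v≢prev eq = next-≢ v (trans (cong next eq) (next-prev v))
    endsAt? : ∀ i → Dec (i ≡ v ⊎ next i ≡ v)
    endsAt? i = (i ≟ v) ⊎-dec (next i ≟ v)
    cycleIncidences : Fin (suc (suc n)) → ℕ
    cycleIncidences i = if does (endsAt? i) then 1 else 0
    cycleNeighbours : ∑ cycleIncidences ≡ 2
    cycleNeighbours = trans (∑-supported₂ cycleIncidences v≢prev λ i i≢v i≢prev → if-no (endsAt? i)
                              λ { (inj₁ i≡v)    → i≢v i≡v
                                ; (inj₂ next≡v) → i≢prev (next-injective (trans next≡v (sym (next-prev v)))) })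
                            (cong₂ _+_ (if-yes (endsAt? v) (inj₁ refl)) (if-yes (endsAt? (prev v)) (inj₂ (next-prev v))))
    -- the pendant end inj₂ _ of an edge is never inj₁ v; that test is the constant no, matched by ⊥-dec
    owner? : ∀ w → Dec (w ≡ v ⊎ ⊥ {ℓ = 0ℓ})
    owner? w = (w ≟ v) ⊎-dec ⊥-dec
    pendantsAt : Fin (suc (suc n)) → ℕ
    pendantsAt w = ∑[ t < P w ] (if does (owner? w) then 1 else 0)
    pendantNeighbours : ∑ pendantsAt ≡ P v
    pendantNeighbours = begin
      ∑ pendantsAt                ≡⟨ ∑-supported₁ pendantsAt (λ w w≢v → ∑-zero {n = P w} λ t →
                                       if-no (owner? w) λ { (inj₁ w≡v) → w≢v w≡v }) ⟩
      pendantsAt v                ≡⟨ sum-cong-≗ {n = P v} (λ t → if-yes (owner? v) (inj₁ refl)) ⟩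
      ∑[ t < P v ] 1              ≡⟨ ∑-const (P v) 1 ⟩
      P v * 1                     ≡⟨ *-identityʳ (P v) ⟩
      P v                         ∎
      where open ≡-Reasoning

  deg-inj₂ : (v : Fin (suc (suc n))) {s : ℕ} → s < P v → deg G (inj₂ (v , s)) ≡ 1
  deg-inj₂ v {s} s<Pv = trans (sum-edges P (incident (inj₂ (v , s))))
                              (cong₂ _+_ (∑-zero {n = suc (suc n)} λ i → refl) (trans (∑-supported₁ pendantsAt others) here))
    where
    t₀ : Fin (P v)
    t₀ = fromℕ< s<Pv
    is? : ∀ w t → Dec (inj₂ (w , t) ≡ inj₂ (v , s))
    is? w t = _≟V_ G (inj₂ (w , t)) (inj₂ (v , s))
    pendantsAt : Fin (suc (suc n)) → ℕ
    pendantsAt w = ∑[ t < P w ] (if does (is? w (toℕ t)) then 1 else 0)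
    others : ∀ w → w ≢ v → pendantsAt w ≡ 0
    others w w≢v = ∑-zero {n = P w} λ t → if-no (is? w (toℕ t)) (w≢v ∘ ,-injectiveˡ ∘ inj₂-injective)
    here : pendantsAt v ≡ 1
    here = trans (∑-supported₁ {j = t₀} _ λ t t≢t₀ → if-no (is? v (toℕ t)) λ eq →
                   t≢t₀ (toℕ-injective (trans (,-injectiveʳ (inj₂-injective eq)) (sym (toℕ-fromℕ< s<Pv)))))
                 (if-yes (is? v (toℕ t₀)) (cong (λ t → inj₂ (v , t)) (toℕ-fromℕ< s<Pv)))

endPendants : (Fin (suc n) → ℕ) → Fin (suc n) → ℕ
endPendants P i = P i + P (next i)

pendantTerm : ℕ → ℕ
pendantTerm p = p * (3 + p) ^ 2

cycleEdgeSum : (Fin (suc n) → ℕ) → ℕ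
cycleEdgeSum {n} P = ∑[ i < suc n ] ((4 + endPendants P i) ^ 2)

pendantEdgeSum : (Fin n → ℕ) → ℕ
pendantEdgeSum {n} P = ∑[ v < n ] pendantTerm (P v)

HM-cycleWithPendants : (P : Fin (suc (suc n)) → ℕ) →
  HM (cycleWithPendants (suc (suc n)) P) ≡ cycleEdgeSum P + pendantEdgeSum P
HM-cycleWithPendants {n} P = trans (sum-edges P edgeTerm) (cong₂ _+_ (sum-cong-≗ cycleEdge) (sum-cong-≗ pendantEdges))
  where
  open ≡-Reasoning
  G : Graph
  G = cycleWithPendants (suc (suc n)) P
  edgeTerm : CVert (suc (suc n)) × CVert (suc (suc n)) → ℕ
  edgeTerm e = (deg G (proj₁ e) + deg G (proj₂ e)) ^ 2
  regroup : ∀ a b → 2 + a + (2 + b) ≡ 4 + (a + b)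
  regroup = solve-∀
  cycleEdge : ∀ i → edgeTerm (inj₁ i , inj₁ (next i)) ≡ (4 + endPendants P i) ^ 2
  cycleEdge i = cong (_^ 2) (begin
    deg G (inj₁ i) + deg G (inj₁ (next i)) ≡⟨ cong₂ _+_ (deg-inj₁ P i) (deg-inj₁ P (next i)) ⟩
    2 + P i + (2 + P (next i))             ≡⟨ regroup (P i) (P (next i)) ⟩
    4 + endPendants P i                    ∎)
  pendantEdges : ∀ v → ∑[ t < P v ] edgeTerm (inj₁ v , inj₂ (v , toℕ t)) ≡ pendantTerm (P v)
  pendantEdges v = begin
    ∑[ t < P v ] edgeTerm (inj₁ v , inj₂ (v , toℕ t))
      ≡⟨ sum-cong-≗ {n = P v} (λ t → cong (_^ 2) (cong₂ _+_ (deg-inj₁ P v) (deg-inj₂ P v (toℕ<n t)))) ⟩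
    ∑[ t < P v ] ((2 + P v + 1) ^ 2) ≡⟨ ∑-const (P v) _ ⟩
    P v * (2 + P v + 1) ^ 2          ≡⟨ cong (λ x → P v * x ^ 2) (+-comm (2 + P v) 1) ⟩
    pendantTerm (P v)                ∎

pendantTerm-superadditive : ∀ {x y} → 1 ≤ x → 1 ≤ y → pendantTerm x + pendantTerm y < pendantTerm (x + y)
pendantTerm-superadditive {x@(suc _)} {y@(suc _)} _ 0<y = begin-strict
  x * (3 + x) ^ 2 + y * (3 + y) ^ 2             <⟨ +-mono-<-≤ (*-monoʳ-< x (^-monoˡ-< 2 3+x<3+x+y))
                                                                (*-monoʳ-≤ y (^-monoˡ-≤ 2 3+y≤3+x+y)) ⟩
  x * (3 + (x + y)) ^ 2 + y * (3 + (x + y)) ^ 2 ≡⟨ *-distribʳ-+ ((3 + (x + y)) ^ 2) x y ⟨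
  (x + y) * (3 + (x + y)) ^ 2                   ∎
  where
  open ≤-Reasoning
  3+x<3+x+y : 3 + x < 3 + (x + y)
  3+x<3+x+y = +-monoʳ-< 3 (m<m+n x 0<y)
  3+y≤3+x+y : 3 + y ≤ 3 + (x + y)
  3+y≤3+x+y = +-monoʳ-≤ 3 (m≤n+m y x)

square-exchange : ∀ k x {c d} → c ≤ d → (k + (x + c)) ^ 2 + (k + d) ^ 2 ≤ (k + c) ^ 2 + (k + (x + d)) ^ 2
square-exchange k x {c} c≤d with m≤n⇒∃[o]m+o≡n c≤d
... | e , refl = begin
  (k + (x + c)) ^ 2 + (k + (c + e)) ^ 2             ≤⟨ m≤m+n _ (2 * x * e) ⟩
  (k + (x + c)) ^ 2 + (k + (c + e)) ^ 2 + 2 * x * e ≡⟨ expand k x c e ⟩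
  (k + c) ^ 2 + (k + (x + (c + e))) ^ 2             ∎
  where
  open ≤-Reasoning
  open +-*-Solver
  expand : ∀ k x c e → (k + (x + c)) ^ 2 + (k + (c + e)) ^ 2 + 2 * x * e ≡ (k + c) ^ 2 + (k + (x + (c + e))) ^ 2
  expand = solve 4 (λ k x c e → (k :+ (x :+ c)) :^ 2 :+ (k :+ (c :+ e)) :^ 2 :+ con 2 :* x :* e
                              := (k :+ c) :^ 2 :+ (k :+ (x :+ (c :+ e))) :^ 2) refl

∑-square-exchange : ∀ k x {p q : Fin m} {L L′ : Fin m → ℕ} → p ≢ q →
  L p ≡ x + L′ p → L′ q ≡ x + L q → L′ p ≤ L q → (∀ i → i ≢ p → i ≢ q → L′ i ≡ L i) →
  ∑[ i < m ] ((k + L i) ^ 2) ≤ ∑[ i < m ] ((k + L′ i) ^ 2)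
∑-square-exchange k x {p} {q} {L} {L′} p≢q Lp Lq L′p≤Lq unchanged =
  ∑-mono-≤-except₂ _ _ p≢q (λ i i≢p i≢q → ≤-reflexive (cong (λ l → (k + l) ^ 2) (sym (unchanged i i≢p i≢q))))
    (subst₂ (λ l l′ → (k + l) ^ 2 + (k + L q) ^ 2 ≤ (k + L′ p) ^ 2 + (k + l′) ^ 2) (sym Lp) (sym Lq)
      (square-exchange k x L′p≤Lq))

record PendantsMoved (a b : Fin m) (P Q : Fin m → ℕ) : Set where
  field
    emptied   : Q a ≡ 0
    merged    : Q b ≡ P a + P b
    unchanged : ∀ v → v ≢ a → v ≢ b → Q v ≡ P v

module _ {a b : Fin (suc (suc n))} {P Q : Fin (suc (suc n)) → ℕ} (moved : PendantsMoved a b P Q) where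
  open PendantsMoved moved

  pendantEdgeSum-< : a ≢ b → 1 ≤ P a → 1 ≤ P b → pendantEdgeSum P < pendantEdgeSum Q
  pendantEdgeSum-< a≢b 1≤Pa 1≤Pb =
    ∑-mono-<-except₂ _ _ a≢b (λ v v≢a v≢b → ≤-reflexive (cong pendantTerm (sym (unchanged v v≢a v≢b))))
      (subst₂ (λ qa qb → pendantTerm (P a) + pendantTerm (P b) < pendantTerm qa + pendantTerm qb)
        (sym emptied) (sym merged) (pendantTerm-superadditive 1≤Pa 1≤Pb))

  cycleEdgeSum-≤-succ : next a ≡ b → {y : Fin (suc (suc n))} → CycleAdj a y → y ≢ b → P y ≤ P b →
    cycleEdgeSum P ≤ cycleEdgeSum Q
  cycleEdgeSum-≤-succ next[a]≡b {y} a~y y≢b Py≤Pb =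
    ∑-square-exchange 4 (P a) y≢b endsPy endsQb (≤-trans (≤-reflexive endsQy) (≤-trans Py≤Pb Pb≤endsPb)) rest
    where
    open ≡-Reasoning
    next[y]≡a : next y ≡ a
    next[y]≡a = neighbour≢succ⇒pred y≢b next[a]≡b a~y
    endsQy : endPendants Q y ≡ P y
    endsQy = begin
      Q y + Q (next y) ≡⟨ cong₂ _+_ (unchanged y (λ y≡a → next-≢ y (trans next[y]≡a (sym y≡a))) y≢b)
                                    (trans (cong Q next[y]≡a) emptied) ⟩
      P y + 0          ≡⟨ +-identityʳ (P y) ⟩
      P y              ∎
    endsPy : endPendants P y ≡ P a + endPendants Q y
    endsPy = begin
      P y + P (next y)      ≡⟨ cong (λ v → P y + P v) next[y]≡a ⟩
      P y + P a             ≡⟨ +-comm (P y) (P a) ⟩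
      P a + P y             ≡⟨ cong (P a +_) endsQy ⟨
      P a + endPendants Q y ∎
    Pb≤endsPb : P b ≤ endPendants P b
    Pb≤endsPb = m≤m+n (P b) (P (next b))
    endsQb : endPendants Q b ≡ P a + endPendants P b
    endsQb = begin
      Q b + Q (next b)       ≡⟨ cong₂ _+_ merged (unchanged (next b) next[b]≢a (next-≢ b)) ⟩
      P a + P b + P (next b) ≡⟨ +-assoc (P a) (P b) _ ⟩
      P a + endPendants P b  ∎
      where
      next[b]≢a : next b ≢ a
      next[b]≢a eq = y≢b (next-injective (trans next[y]≡a (sym eq)))
    rest : ∀ i → i ≢ y → i ≢ b → endPendants Q i ≡ endPendants P i
    rest i i≢y i≢b with i ≟ a
    ... | yes refl = begin
      Q i + Q (next i) ≡⟨ cong₂ _+_ emptied (trans (cong Q next[a]≡b) merged) ⟩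
      P i + P b        ≡⟨ cong (λ v → P i + P v) next[a]≡b ⟨
      endPendants P i  ∎
    ... | no i≢a = cong₂ _+_ (unchanged i i≢a i≢b)
                             (unchanged (next i) (λ eq → i≢y (next-injective (trans eq (sym next[y]≡a))))
                                                 (λ eq → i≢a (next-injective (trans eq (sym next[a]≡b)))))

  cycleEdgeSum-≤-pred : next b ≡ a → {y : Fin (suc (suc n))} → CycleAdj a y → y ≢ b → P y ≤ P b →
    cycleEdgeSum P ≤ cycleEdgeSum Q
  cycleEdgeSum-≤-pred next[b]≡a {y} a~y y≢b Py≤Pb =
    ∑-square-exchange 4 (P a) a≢w endsPa endsQw (≤-trans (≤-reflexive endsQa) (≤-trans Py≤Pb Pb≤endsPw)) rest
    where
    open ≡-Reasoning
    next[a]≡y : next a ≡ y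
    next[a]≡y = neighbour≢pred⇒succ y≢b next[b]≡a a~y
    w : Fin (suc (suc n))
    w = prev b
    a≢w : a ≢ w
    a≢w a≡w = y≢b (trans (sym next[a]≡y) (trans (cong next a≡w) (next-prev b)))
    endsQa : endPendants Q a ≡ P y
    endsQa = cong₂ _+_ emptied (trans (cong Q next[a]≡y) (unchanged y (λ y≡a → next-≢ a (trans next[a]≡y y≡a)) y≢b))
    endsPa : endPendants P a ≡ P a + endPendants Q a
    endsPa = cong (P a +_) (trans (cong P next[a]≡y) (sym endsQa))
    endsPw : endPendants P w ≡ P w + P b
    endsPw = cong (λ v → P w + P v) (next-prev b)
    Pb≤endsPw : P b ≤ endPendants P w
    Pb≤endsPw = subst (P b ≤_) (sym endsPw) (m≤n+m (P b) (P w))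
    endsQw : endPendants Q w ≡ P a + endPendants P w
    endsQw = begin
      Q w + Q (next w)      ≡⟨ cong₂ _+_ (unchanged w (a≢w ∘ sym) w≢b) (trans (cong Q (next-prev b)) merged) ⟩
      P w + (P a + P b)     ≡⟨ x∙yz≈y∙xz (P w) (P a) (P b) ⟩
      P a + (P w + P b)     ≡⟨ cong (P a +_) endsPw ⟨
      P a + endPendants P w ∎
      where
      w≢b : w ≢ b
      w≢b w≡b = next-≢ b (trans (cong next (sym w≡b)) (next-prev b))
    rest : ∀ i → i ≢ a → i ≢ w → endPendants Q i ≡ endPendants P i
    rest i i≢a i≢w with i ≟ b
    ... | yes refl = begin
      Q i + Q (next i) ≡⟨ cong₂ _+_ merged (trans (cong Q next[b]≡a) emptied) ⟩
      P a + P i + 0    ≡⟨ +-identityʳ (P a + P i) ⟩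
      P a + P i        ≡⟨ +-comm (P a) (P i) ⟩
      P i + P a        ≡⟨ cong (λ v → P i + P v) next[b]≡a ⟨
      endPendants P i  ∎
    ... | no i≢b = cong₂ _+_ (unchanged i i≢a i≢b)
                             (unchanged (next i) (λ eq → i≢b (next-injective (trans eq (sym next[b]≡a))))
                                                 (λ eq → i≢w (next-injective (trans eq (sym (next-prev b))))))

  cycleEdgeSum-≤ : CycleAdj a b → {y : Fin (suc (suc n))} → CycleAdj a y → y ≢ b → P y ≤ P b →
    cycleEdgeSum P ≤ cycleEdgeSum Q
  cycleEdgeSum-≤ (inj₁ next[a]≡b) = cycleEdgeSum-≤-succ next[a]≡b
  cycleEdgeSum-≤ (inj₂ next[b]≡a) = cycleEdgeSum-≤-pred next[b]≡a

  HM-<-movePendants : CycleAdj a b → {y : Fin (suc (suc n))} → CycleAdj a y → y ≢ b →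
    1 ≤ P a → 1 ≤ P b → P y ≤ P b → HM (cycleWithPendants (suc (suc n)) P) < HM (cycleWithPendants (suc (suc n)) Q)
  HM-<-movePendants a~b a~y y≢b 1≤Pa 1≤Pb Py≤Pb =
    subst₂ _<_ (sym (HM-cycleWithPendants P)) (sym (HM-cycleWithPendants Q))
      (+-mono-≤-< (cycleEdgeSum-≤ a~b a~y y≢b Py≤Pb) (pendantEdgeSum-< (CycleAdj⇒≢ a~b) 1≤Pa 1≤Pb))

pendCount-∑ : ∀ {k} (u : Fin k → Fin m) (l : Fin k → ℕ) v →
  pendCount u l v ≡ ∑[ r < k ] (if does (u r ≟ v) then l r else 0)
pendCount-∑ u l v = sum-map-tabulate (λ r → if does (u r ≟ v) then l r else 0) id

pendCount-at : ∀ {k} {u : Fin k → Fin m} → Injective _≡_ _≡_ u → ∀ l s → pendCount u l (u s) ≡ l s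
pendCount-at {u = u} u-inj l s = begin
  pendCount u l (u s)                              ≡⟨ pendCount-∑ u l (u s) ⟩
  ∑[ r < _ ] (if does (u r ≟ u s) then l r else 0) ≡⟨ ∑-supported₁ _ (λ r r≢s → if-no (u r ≟ u s) (r≢s ∘ u-inj)) ⟩
  (if does (u s ≟ u s) then l s else 0)            ≡⟨ if-yes (u s ≟ u s) refl ⟩
  l s                                              ∎
  where open ≡-Reasoning

module _ {k} (l : Fin k → ℕ) {i j : Fin k} where

  movePendants-source : movePendants l i j i ≡ 0
  movePendants-source = if-yes (i ≟ i) refl

  movePendants-target : j ≢ i → movePendants l i j j ≡ l i + l j
  movePendants-target j≢i = trans (if-no (j ≟ i) j≢i) (if-yes (j ≟ j) refl)

  movePendants-other : ∀ {r} → r ≢ i → r ≢ j → movePendants l i j r ≡ l r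
  movePendants-other {r} r≢i r≢j = trans (if-no (r ≟ i) r≢i) (if-no (r ≟ j) r≢j)

  movePendants-moves : {u : Fin k → Fin m} → Injective _≡_ _≡_ u → j ≢ i →
    PendantsMoved (u i) (u j) (pendCount u l) (pendCount u (movePendants l i j))
  movePendants-moves {u = u} u-inj j≢i = record
    { emptied   = trans (pendCount-at u-inj (movePendants l i j) i) movePendants-source
    ; merged    = trans (pendCount-at u-inj (movePendants l i j) j)
                    (trans (movePendants-target j≢i) (sym (cong₂ _+_ (pendCount-at u-inj l i) (pendCount-at u-inj l j))))
    ; unchanged = λ v v≢ui v≢uj → trans (pendCount-∑ u (movePendants l i j) v)
                    (trans (sum-cong-≗ (away v v≢ui v≢uj)) (sym (pendCount-∑ u l v)))
    }
    where
    away : ∀ v → v ≢ u i → v ≢ u j → ∀ r →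
      (if does (u r ≟ v) then movePendants l i j r else 0) ≡ (if does (u r ≟ v) then l r else 0)
    away v v≢ui v≢uj r with u r ≟ v
    ... | yes refl = movePendants-other (v≢ui ∘ cong u) (v≢uj ∘ cong u)
    ... | no _     = refl

lemma2p5 : (m k : ℕ) → 3 ≤ m → 2 ≤ k
    → (u : Fin k → Fin m) → Injective _≡_ _≡_ u
    → (l : Fin k → ℕ) → (∀ r → 1 ≤ l r)
    → (first i j : Fin k) → toℕ first ≡ 0 → toℕ j ≡ suc (toℕ i)
    → CycleAdj (u i) (u j)
    → (y₁ : Fin m) → CycleAdj (u i) y₁ → y₁ ≢ u j
    → deg C[ m , u , l ] (inj₁ y₁) ≤ deg C[ m , u , l ] (inj₁ (u j))
    → deg C[ m , u , l ] (inj₁ (u first)) ≤ deg C[ m , u , l ] (inj₁ (u j))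
    → HM C[ m , u , l ] < HM C[ m , u , movePendants l i j ]
lemma2p5 (suc (suc (suc n))) k (s≤s (s≤s (s≤s _))) _ u u-inj l 1≤l _ i j _ j≡1+i ui~uj y ui~y y≢uj deg-y≤deg-uj _ =
  HM-<-movePendants (movePendants-moves l u-inj j≢i) ui~uj ui~y y≢uj
    (subst (1 ≤_) (sym (pendCount-at u-inj l i)) (1≤l i))
    (subst (1 ≤_) (sym (pendCount-at u-inj l j)) (1≤l j))
    (+-cancelˡ-≤ 2 _ _ (subst₂ _≤_ (deg-inj₁ P y) (deg-inj₁ P (u j)) deg-y≤deg-uj))
  where
  P : Fin (suc (suc (suc n))) → ℕ
  P = pendCount u l
  j≢i : j ≢ i
  j≢i refl = 1+n≢n (sym j≡1+i)
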